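{- Let $(T',M')$ be a weakly feasible maze pair. Then $T'$ is feasible, i.e. $d(T'\cap T_e)\le u_e$ for every edge $e$.
   Context: A UFP instance: a path $G=(V,E)$ with vertices $1,\dots,n$ from left to right, edge capacities $u_e\in\mathbb{Z}_{>0}$, and a finite set $T$ of tasks, each task $i$ having a subpath $P(i)$ from $s(i)$ to $t(i)$, demand $d(i)>0$ and profit $w(i)\ge0$. $T_e=\{i: e\in P(i)\}$; $d(S)$ is the sum of demands of a set $S$. The bottleneck capacity is $b(i)=\min_{e\in P(i)}u_e$ and $e(i)$ the edge of $P(i)$ with capacity $b(i)$. Standing assumptions: edge capacities are pairwise distinct, $d(i)\le b(i)$ for all $i$, every vertex is the start or end vertex of exactly one task. Fix $\delta\in(0,1]$. M-tasks: for every pair of tasks $i,j$ (possibly equal) with $e(i)=e(j)=e$ there is an m-task $m$ with $P(m)=P(i)\cup P(j)$, $b(m)=u_e$, $e(m)=e$, $d(m)=\delta u_e$, profit $0$; $M$ is the set of m-tasks, $M_e=\{m\in M:e\in P(m)\}$. A maze pair is $(T',M')$ with $T'\subseteq T$, $M'\subseteq M$, and distinct m-tasks of $M'$ having distinct bottleneck capacities. For $m\in M$ and $T'\subseteq T$, let $T'(m)=\{i\in T': P(i)\cap P(m)\neq\emptyset\}$ (sharing an edge), $abv(m,T')=\{i\in T'(m): b(i)>b(m)\}$, $crit(m,T')=\{i\in T'(m): b(m)\ge b(i)\ge\frac{\delta}{2}b(m)\}$, and $abv_e(m,T')=abv(m,T')\cap T_e$, $crit_e(m,T')=crit(m,T')\cap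 T_e$. A maze pair $(T',M')$ is weakly feasible if for every edge $e$: if $M'\cap M_e\neq\emptyset$, then with $m_e$ the m-task in $M'\cap M_e$ of largest bottleneck capacity, $d(abv_e(m_e,T'))+d(crit_e(m_e,T'))+d(m_e)\le u_e$; and if $M'\cap M_e=\emptyset$, then $d(T'\cap T_e)\le u_e$.
   Formalization: The demands d(i), the profits w(i) and the parameter δ take only rational values. -}

module Defs where

open import Data.Nat as ℕ using (ℕ)
open import Data.Integer using (+_)
open import Data.Fin using (Fin; toℕ)
open import Data.Fin.Properties using (any?)
open import Data.Rational using (ℚ; 0ℚ; 1ℚ; ½; _/_; _+_; _*_; _≤_; _<_)
open import Data.Rational.Properties using (_≤?_; _<?_)
open import Data.Bool using (Bool; true; _∧_; if_then_else_)
open import Data.List using (foldr; allFin)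
open import Data.Product using (Σ; ∃; _×_; _,_)
open import Data.Sum using (_⊎_)
open import Relation.Binary.PropositionalEquality using (_≡_)
open import Relation.Nullary using (¬_; Dec; does)
open import Relation.Nullary.Decidable using (_×-dec_; _⊎-dec_)

toℚ : ℕ → ℚ
toℚ n = + n / 1

sumSel : {N : ℕ} → (Fin N → Bool) → (Fin N → ℚ) → ℚ
sumSel {N} sel f = foldr (λ i acc → (if sel i then f i else 0ℚ) + acc) 0ℚ (allFin N)

-- Vertices are 0,1,…,k (left to right); edge e : Fin k joins vertices e and e+1.
-- Tasks are the elements of Fin N; task i has subpath from vertex s i to vertex t i.
record Instance : Set where
  field
    k : ℕ
    N : ℕ
    u : Fin k → ℕ
    s : Fin N → ℕ
    t : Fin N → ℕ
    d : Fin N → ℚ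
    w : Fin N → ℚ

module _ (I : Instance) where
  open Instance I

  _∈P_ : Fin k → Fin N → Set
  e ∈P i = (s i ℕ.≤ toℕ e) × (toℕ e ℕ.< t i)

  _∈P?_ : (e : Fin k) (i : Fin N) → Dec (e ∈P i)
  e ∈P? i = (s i ℕ.≤? toℕ e) ×-dec (toℕ e ℕ.<? t i)

  IsBottleneck : Fin N → Fin k → Set
  IsBottleneck i e = (e ∈P i) × (∀ f → f ∈P i → u e ℕ.≤ u f)

  record Standing (eb : Fin N → Fin k) : Set where
    field
      u-pos      : ∀ e → 0 ℕ.< u e
      u-distinct : ∀ e f → u e ≡ u f → e ≡ f
      s<t        : ∀ i → s i ℕ.< t i
      t≤k        : ∀ i → t i ℕ.≤ k
      d-pos      : ∀ i → 0ℚ < d i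
      w-nonneg   : ∀ i → 0ℚ ≤ w i
      eb-bottleneck : ∀ i → IsBottleneck i (eb i)
      d≤b        : ∀ i → d i ≤ toℚ (u (eb i))
      vertex-unique : ∀ v → v ℕ.≤ k →
        Σ (Fin N) λ i → ((s i ≡ v) ⊎ (t i ≡ v)) ×
          (∀ j → ((s j ≡ v) ⊎ (t j ≡ v)) → j ≡ i)

  module _ (eb : Fin N → Fin k) where

    b : Fin N → ℚ
    b i = toℚ (u (eb i))

    -- The m-task of the pair (a , c) (meaningful when eb a ≡ eb c):
    -- P(m) = P(a) ∪ P(c), b(m) = u_{e(a)}, d(m) = δ·u_{e(a)}.
    _∈Pm_ : Fin k → Fin N × Fin N → Set
    e ∈Pm (a , c) = (e ∈P a) ⊎ (e ∈P c)

    bm : Fin N × Fin N → ℚ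
    bm (a , c) = b a

    dm : ℚ → Fin N × Fin N → ℚ
    dm δ m = δ * bm m

    Shares : Fin N → Fin N × Fin N → Set
    Shares i m = ∃ λ f → (f ∈P i) × (f ∈Pm m)

    shares? : ∀ i m → Dec (Shares i m)
    shares? i (a , c) = any? (λ f → (f ∈P? i) ×-dec ((f ∈P? a) ⊎-dec (f ∈P? c)))

    selTe : (Fin N → Bool) → Fin k → Fin N → Bool
    selTe T' e i = T' i ∧ does (e ∈P? i)

    selAbv : (Fin N → Bool) → Fin k → Fin N × Fin N → Fin N → Bool
    selAbv T' e m i = T' i ∧ does (shares? i m) ∧ does (e ∈P? i) ∧ does (bm m <? b i)

    selCrit : ℚ → (Fin N → Bool) → Fin k → Fin N × Fin N → Fin N → Bool
    selCrit δ T' e m i = T' i ∧ does (shares? i m) ∧ does (e ∈P? i)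
                         ∧ does (b i ≤? bm m) ∧ does ((½ * δ) * bm m ≤? b i)

    -- A maze pair (T', M'): T' ⊆ T as a Boolean selector, M' ⊆ M as a predicate
    -- on pairs (a , c) of tasks with e(a) = e(c); distinct m-tasks of M' have
    -- distinct bottleneck capacities.
    record MazePair (T' : Fin N → Bool) (M' : Fin N → Fin N → Set) : Set where
      field
        M'-mtask    : ∀ a c → M' a c → eb a ≡ eb c
        M'-distinct : ∀ a c a' c' → M' a c → M' a' c' → bm (a , c) ≡ bm (a' , c') →
                      ((a ≡ a') × (c ≡ c')) ⊎ ((a ≡ c') × (c ≡ a'))

    -- For an edge e with M' ∩ M_e ≠ ∅, the condition is imposed
    -- on the m-task m_e of M' ∩ M_e of largest bottleneck capacity (stated as:
    -- for every m ∈ M' ∩ M_e whose bottleneck capacity is maximal in M' ∩ M_e).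
    WeaklyFeasible : ℚ → (Fin N → Bool) → (Fin N → Fin N → Set) → Set
    WeaklyFeasible δ T' M' = ∀ e →
      (∀ a c → M' a c → e ∈Pm (a , c) →
         (∀ a' c' → M' a' c' → e ∈Pm (a' , c') → bm (a' , c') ≤ bm (a , c)) →
         sumSel (selAbv T' e (a , c)) d + sumSel (selCrit δ T' e (a , c)) d
           + dm δ (a , c) ≤ toℚ (u e))
      × ((∀ a c → M' a c → ¬ (e ∈Pm (a , c))) →
         sumSel (selTe T' e) d ≤ toℚ (u e))

    Feasible : (Fin N → Bool) → Set
    Feasible T' = ∀ e → sumSel (selTe T' e) d ≤ toℚ (u e)

module Submission where

-- Fix an edge e; we show d(T' ∩ T_e) ≤ u_e by strong induction on u_e.  If no
-- m-task of M' uses e, weak feasibility states exactly this bound.  Otherwise take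
-- an m-task m of M' ∩ M_e of largest bottleneck capacity and put c = (δ/2)·b(m).
-- Every task of T' through e lies in abv(m,T'), in crit(m,T'), or is c-light
-- (b(i) < c) with its bottleneck edge weakly left or weakly right of e.  The
-- c-light tasks of each side weigh at most c (the sweep lemma): walking away from
-- e, an edge g with u_g < c ≤ u_e carries all of them and is feasible by
-- induction, while an edge with u_g ≥ c is the bottleneck of none of them, so the
-- set only shrinks when the walk crosses it.  Hence
-- d(T' ∩ T_e) ≤ d(abv) + d(crit) + 2c = d(abv) + d(crit) + d(m) ≤ u_e.

open import Defs
open import Data.Fin using (Fin)
open import Data.Bool using (Bool)
open import Data.Rational using (ℚ; 0ℚ; 1ℚ; _<_; _≤_)

open import Level using (0ℓ)
open import Function using (_∘_; Equivalence)
open import Data.Nat as ℕ using (ℕ; zero; suc; z≤n)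
import Data.Nat.Properties as ℕP
open import Data.Nat.Induction using (<-wellFounded)
import Data.Integer as ℤ
import Data.Integer.Properties as ℤP
import Data.Nat.Coprimality as Coprime
open import Data.Rational using (½; _+_; _*_; mkℚ; *≤*; nonNegative)
import Data.Rational.Properties as QP
open import Data.Fin using (toℕ; fromℕ<)
import Data.Fin.Properties as FinP
open import Data.Bool using (true; false; T; _∧_; _∨_; if_then_else_)
open import Data.Bool.Properties using (T-∧; T-∨)
open import Data.List using (List; []; _∷_; foldr; allFin)
open import Data.Product using (_×_; _,_; proj₁; proj₂)
open import Data.Sum using (_⊎_; inj₁; inj₂)
open import Data.Empty using (⊥; ⊥-elim)
open import Data.Unit using (tt)
open import Relation.Binary.PropositionalEquality
open import Relation.Nullary using (¬_; Dec; yes; no; does)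
open import Relation.Nullary.Decidable
  using (T?; _×-dec_; toWitness; decidable-stable)
import Relation.Binary.Construct.On as On
import Induction.WellFounded as WF
open import Algebra.Bundles using (CommutativeMonoid)
open import Algebra.Properties.CommutativeSemigroup
  (CommutativeMonoid.commutativeSemigroup QP.+-0-commutativeMonoid) using (interchange)

-- Σ_{x ∈ xs} g x, folded exactly as in sumSel
sumList : {A : Set} → (A → ℚ) → List A → ℚ
sumList g = foldr (λ x acc → g x + acc) 0ℚ

sumList-split : {A : Set} {g g₁ g₂ : A → ℚ} (xs : List A) →
                (∀ x → g x ≤ g₁ x + g₂ x) → sumList g xs ≤ sumList g₁ xs + sumList g₂ xs
sumList-split [] _ = QP.≤-refl
sumList-split {g = g} {g₁} {g₂} (x ∷ xs) le = begin
  g x + sumList g xs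
    ≤⟨ QP.+-mono-≤ (le x) (sumList-split {g₁ = g₁} {g₂} xs le) ⟩
  (g₁ x + g₂ x) + (sumList g₁ xs + sumList g₂ xs)
    ≡⟨ interchange (g₁ x) (g₂ x) (sumList g₁ xs) (sumList g₂ xs) ⟩
  sumList g₁ (x ∷ xs) + sumList g₂ (x ∷ xs) ∎
  where open QP.≤-Reasoning

sumList-zero : {A : Set} {g : A → ℚ} (xs : List A) → (∀ x → g x ≡ 0ℚ) → sumList g xs ≡ 0ℚ
sumList-zero [] _ = refl
sumList-zero {g = g} (x ∷ xs) zero-at
  rewrite zero-at x | sumList-zero xs zero-at = refl

selected : Bool → ℚ → ℚ
selected sel x = if sel then x else 0ℚ

selected-nonneg : ∀ sel {x} → 0ℚ ≤ x → 0ℚ ≤ selected sel x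
selected-nonneg true  x≥0 = x≥0
selected-nonneg false _   = QP.≤-refl

selected-cover : ∀ {sel sel₁ sel₂ x} → 0ℚ ≤ x → (T sel → T sel₁ ⊎ T sel₂) →
                 selected sel x ≤ selected sel₁ x + selected sel₂ x
selected-cover {false} {sel₁} {sel₂} x≥0 _ =
  QP.+-mono-≤ (selected-nonneg sel₁ x≥0) (selected-nonneg sel₂ x≥0)
selected-cover {true} {true} {sel₂} {x} x≥0 _ = begin
  x                       ≡⟨ QP.+-identityʳ x ⟨
  x + 0ℚ                  ≤⟨ QP.+-monoʳ-≤ x (selected-nonneg sel₂ x≥0) ⟩
  x + selected sel₂ x     ∎
  where open QP.≤-Reasoning
selected-cover {true} {false} {true} {x} _ _ = QP.≤-reflexive (sym (QP.+-identityˡ x))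
selected-cover {true} {false} {false} _ cover with cover tt
... | inj₁ ()
... | inj₂ ()

selected-empty : ∀ {sel} x → ¬ T sel → selected sel x ≡ 0ℚ
selected-empty {true}  _ unselected = ⊥-elim (unselected tt)
selected-empty {false} _ _          = refl

module Selections {N : ℕ} (f : Fin N → ℚ) (f≥0 : ∀ i → 0ℚ ≤ f i) where

  sumSel-cover : ∀ {sel sel₁ sel₂ : Fin N → Bool} →
                 (∀ i → T (sel i) → T (sel₁ i) ⊎ T (sel₂ i)) →
                 sumSel sel f ≤ sumSel sel₁ f + sumSel sel₂ f
  sumSel-cover {sel₁ = sel₁} {sel₂} cover =
    sumList-split {g₁ = λ i → selected (sel₁ i) (f i)} {g₂ = λ i → selected (sel₂ i) (f i)} (allFin N) (λ i → selected-cover (f≥0 i) (cover i))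

  sumSel-∨ : ∀ {sel₁ sel₂ : Fin N → Bool} →
             sumSel (λ i → sel₁ i ∨ sel₂ i) f ≤ sumSel sel₁ f + sumSel sel₂ f
  sumSel-∨ {sel₁} {sel₂} = sumSel-cover {sel₁ = sel₁} {sel₂} (λ i → Equivalence.to T-∨)

  sumSel-empty : ∀ {sel : Fin N → Bool} → (∀ i → ¬ T (sel i)) → sumSel sel f ≡ 0ℚ
  sumSel-empty unselected = sumList-zero (allFin N) (λ i → selected-empty (f i) (unselected i))

  sumSel-mono : ∀ {sel sel' : Fin N → Bool} → (∀ i → T (sel i) → T (sel' i)) →
                sumSel sel f ≤ sumSel sel' f
  sumSel-mono {sel} {sel'} sub = begin
    sumSel sel f                            ≤⟨ sumSel-cover {sel₂ = λ _ → false} (λ i → inj₁ ∘ sub i) ⟩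
    sumSel sel' f + sumSel (λ _ → false) f  ≡⟨ cong (sumSel sel' f +_) (sumSel-empty {sel = λ _ → false} (λ _ ())) ⟩
    sumSel sel' f + 0ℚ                      ≡⟨ QP.+-identityʳ (sumSel sel' f) ⟩
    sumSel sel' f                           ∎
    where open QP.≤-Reasoning

-- toℚ n is the reduced fraction n/1; in this form ℕ-order transfers to ℚ
toℚ≡mkℚ : ∀ n → toℚ n ≡ mkℚ (ℤ.+ n) 0 (Coprime.sym (Coprime.1-coprimeTo n))
toℚ≡mkℚ n = QP.normalize-coprime (Coprime.sym (Coprime.1-coprimeTo n))

toℚ-mono : ∀ {m n} → m ℕ.≤ n → toℚ m ≤ toℚ n
toℚ-mono {m} {n} m≤n rewrite toℚ≡mkℚ m | toℚ≡mkℚ n =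
  *≤* (ℤP.*-monoʳ-≤-nonNeg (ℤ.+ 1) (ℤ.+≤+ m≤n))

toℚ-cancel-< : ∀ {m n} → toℚ m < toℚ n → m ℕ.< n
toℚ-cancel-< m<n = ℕP.≰⇒> (λ n≤m → QP.<-irrefl refl (QP.<-≤-trans m<n (toℚ-mono n≤m)))

toℚ-nonneg : ∀ n → 0ℚ ≤ toℚ n
toℚ-nonneg n = toℚ-mono {0} {n} z≤n

scale-≤ : ∀ {r x} → r ≤ 1ℚ → 0ℚ ≤ x → r * x ≤ x
scale-≤ {r} {x} r≤1 x≥0 = begin
  r * x   ≤⟨ QP.*-monoʳ-≤-nonNeg x {{nonNegative x≥0}} r≤1 ⟩
  1ℚ * x  ≡⟨ QP.*-identityˡ x ⟩
  x       ∎
  where open QP.≤-Reasoning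

scale-nonneg : ∀ {r x} → 0ℚ ≤ r → 0ℚ ≤ x → 0ℚ ≤ r * x
scale-nonneg {r} {x} r≥0 x≥0 = QP.nonNegative⁻¹ (r * x)
  {{QP.nonNeg*nonNeg⇒nonNeg r {{nonNegative r≥0}} x {{nonNegative x≥0}}}}

halves : ∀ δ x → (½ * δ) * x + (½ * δ) * x ≡ δ * x
halves δ x = begin
  (½ * δ) * x + (½ * δ) * x  ≡⟨ QP.*-distribʳ-+ x (½ * δ) (½ * δ) ⟨
  ((½ * δ) + (½ * δ)) * x    ≡⟨ cong (_* x) (QP.*-distribʳ-+ δ ½ ½) ⟨
  ((½ + ½) * δ) * x          ≡⟨ cong (_* x) (QP.*-identityˡ δ) ⟩
  δ * x                      ∎
  where open ≡-Reasoning

measure-induction : {X : Set} (μ : X → ℕ) (Q : X → Set) →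
                    (∀ x → (∀ y → μ y ℕ.< μ x → Q y) → Q x) → ∀ x → Q x
measure-induction μ Q step =
  WF.All.wfRec (On.wellFounded μ <-wellFounded) 0ℓ Q (λ x rec → step x (λ y → rec))

-- If a statement fails at every maximal element of P (maximal for a size
-- bounded on P), then P is empty.  No maximal element has to be computed.
refute-at-maximal : {X : Set} (P : X → Set) (size : X → ℕ) (K : ℕ) →
                    (∀ x → P x → size x ℕ.≤ K) →
                    (∀ x → P x → (∀ y → P y → size y ℕ.≤ size x) → ⊥) →
                    ∀ x → P x → ⊥
refute-at-maximal P size K bounded refute x px = climb K x px (ℕP.m≤m+n K (size x))
  where
  -- the slack K - size x decreases each time a larger element of P is found
  climb : ∀ slack x → P x → K ℕ.≤ slack ℕ.+ size x → ⊥
  larger : ∀ slack {x} → K ℕ.≤ slack ℕ.+ size x → ∀ y → P y → size x ℕ.< size y → ⊥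

  climb slack x px K≤ = refute x px maximal
    where
    maximal : ∀ y → P y → size y ℕ.≤ size x
    maximal y py with size y ℕ.≤? size x
    ... | yes y≤x = y≤x
    ... | no  y≰x = ⊥-elim (larger slack K≤ y py (ℕP.≰⇒> y≰x))

  larger zero K≤ y py x<y = ℕP.<-irrefl refl (ℕP.≤-<-trans K≤ (ℕP.<-≤-trans x<y (bounded y py)))
  larger (suc slack) {x} K≤ y py x<y = climb slack y py (begin
    K                      ≤⟨ K≤ ⟩
    suc slack ℕ.+ size x   ≡⟨ ℕP.+-suc slack (size x) ⟨
    slack ℕ.+ suc (size x) ≤⟨ ℕP.+-monoʳ-≤ slack x<y ⟩
    slack ℕ.+ size y       ∎)
    where open ℕP.≤-Reasoning

does-sound : ∀ {A : Set} (a? : Dec A) → T (does a?) → A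
does-sound (yes a) _ = a

does-complete : ∀ {A : Set} (a? : Dec A) → A → T (does a?)
does-complete (yes _) _ = tt
does-complete (no ¬a) a = ¬a a

both : ∀ {x y} → T x → T y → T (x ∧ y)
both tx ty = Equivalence.from T-∧ (tx , ty)

parts-∧ : ∀ {x y} → T (x ∧ y) → T x × T y
parts-∧ = Equivalence.to T-∧

module Loads (I : Instance) (eb : Fin (Instance.N I) → Fin (Instance.k I))
             (St : Standing I eb) (T' : Fin (Instance.N I) → Bool) where
  open Instance I
  open Standing St

  B : Fin N → ℚ
  B = b I eb

  d≥0 : ∀ i → 0ℚ ≤ d i
  d≥0 i = QP.<⇒≤ (d-pos i)

  open Selections d d≥0

  load : Fin k → ℚ
  load e = sumSel (selTe I eb T' e) d

  FeasibleBelow : ℚ → Set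
  FeasibleBelow c = ∀ g → toℚ (u g) < c → load g ≤ toℚ (u g)

  LightThrough : ℚ → ℕ → Fin N → Set
  LightThrough c n i = T (T' i) × (s i ℕ.≤ n × n ℕ.< t i) × B i < c

  lightThrough? : ∀ c n i → Dec (LightThrough c n i)
  lightThrough? c n i = T? (T' i) ×-dec (s i ℕ.≤? n ×-dec n ℕ.<? t i) ×-dec (B i QP.<? c)

  leftLight : ℚ → ℕ → Fin N → Bool
  leftLight c n i = does (lightThrough? c n i ×-dec toℕ (eb i) ℕ.≤? n)

  rightLight : ℚ → ℕ → Fin N → Bool
  rightLight c n i = does (lightThrough? c n i ×-dec n ℕ.≤? toℕ (eb i))

  leftLight-sound : ∀ {c n i} → T (leftLight c n i) → LightThrough c n i × toℕ (eb i) ℕ.≤ n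
  leftLight-sound {c} {n} {i} = does-sound (lightThrough? c n i ×-dec toℕ (eb i) ℕ.≤? n)

  leftLight-complete : ∀ {c n i} → LightThrough c n i → toℕ (eb i) ℕ.≤ n → T (leftLight c n i)
  leftLight-complete {c} {n} {i} through eb≤n =
    does-complete (lightThrough? c n i ×-dec toℕ (eb i) ℕ.≤? n) (through , eb≤n)

  rightLight-sound : ∀ {c n i} → T (rightLight c n i) → LightThrough c n i × n ℕ.≤ toℕ (eb i)
  rightLight-sound {c} {n} {i} = does-sound (lightThrough? c n i ×-dec n ℕ.≤? toℕ (eb i))

  rightLight-complete : ∀ {c n i} → LightThrough c n i → n ℕ.≤ toℕ (eb i) → T (rightLight c n i)
  rightLight-complete {c} {n} {i} through n≤eb =
    does-complete (lightThrough? c n i ×-dec n ℕ.≤? toℕ (eb i)) (through , n≤eb)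

  bottleneck-on-path : ∀ i → s i ℕ.≤ toℕ (eb i) × toℕ (eb i) ℕ.< t i
  bottleneck-on-path i = proj₁ (eb-bottleneck i)

  on-path : ∀ {n i} (g : Fin k) → toℕ g ≡ n → s i ℕ.≤ n × n ℕ.< t i → _∈P_ I g i
  on-path g refl through = through

  heavy-not-bottleneck : ∀ {c n i} (g : Fin k) → toℕ g ≡ n → ¬ toℚ (u g) < c →
                         LightThrough c n i → toℕ (eb i) ≢ n
  heavy-not-bottleneck {c} g g≡n heavy (_ , _ , light) eb≡n =
    heavy (subst (λ h → toℚ (u h) < c) (FinP.toℕ-injective (trans eb≡n (sym g≡n))) light)

  module Sweep {c : ℚ} (below : FeasibleBelow c) (c≥0 : 0ℚ ≤ c) where

    sweep-step : ∀ (sel : Fin N → Bool) n → (∀ i → T (sel i) → LightThrough c n i) →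
                 ((g : Fin k) → toℕ g ≡ n → ¬ toℚ (u g) < c → sumSel sel d ≤ c) →
                 sumSel sel d ≤ c
    sweep-step sel n through heavy with n ℕ.<? k
    ... | no n≮k = QP.≤-trans (QP.≤-reflexive (sumSel-empty off-path)) c≥0
      where
      off-path : ∀ i → ¬ T (sel i)
      off-path i selected-i =
        n≮k (ℕP.<-≤-trans (proj₂ (proj₁ (proj₂ (through i selected-i)))) (t≤k i))
    ... | yes n<k with toℚ (u (fromℕ< n<k)) QP.<? c
    ...   | no  not-light = heavy (fromℕ< n<k) (FinP.toℕ-fromℕ< n<k) not-light
    ...   | yes light = begin
      sumSel sel d     ≤⟨ sumSel-mono carried ⟩
      load g           ≤⟨ below g light ⟩
      toℚ (u g)        ≤⟨ QP.<⇒≤ light ⟩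
      c                ∎
      where
      open QP.≤-Reasoning
      g : Fin k
      g = fromℕ< n<k
      carried : ∀ i → T (sel i) → T (selTe I eb T' g i)
      carried i selected-i with through i selected-i
      ... | i∈T' , through-n , _ =
        both i∈T' (does-complete (_∈P?_ I g i) (on-path g (FinP.toℕ-fromℕ< n<k) through-n))

    left-sweep : ∀ n → sumSel (leftLight c n) d ≤ c
    left-sweep zero = sweep-step _ zero (λ _ → proj₁ ∘ leftLight-sound) heavy
      where
      heavy : (g : Fin k) → toℕ g ≡ 0 → ¬ toℚ (u g) < c → sumSel (leftLight c 0) d ≤ c
      heavy g g≡0 not-light = QP.≤-trans (QP.≤-reflexive (sumSel-empty none)) c≥0
        where
        none : ∀ i → ¬ T (leftLight c 0 i)
        none i sel-i with leftLight-sound sel-i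
        ... | through , eb≤0 =
          heavy-not-bottleneck g g≡0 not-light through (ℕP.n≤0⇒n≡0 eb≤0)
    left-sweep (suc n) = sweep-step _ (suc n) (λ _ → proj₁ ∘ leftLight-sound) heavy
      where
      heavy : (g : Fin k) → toℕ g ≡ suc n → ¬ toℚ (u g) < c →
              sumSel (leftLight c (suc n)) d ≤ c
      heavy g g≡n not-light = QP.≤-trans (sumSel-mono shift) (left-sweep n)
        where
        shift : ∀ i → T (leftLight c (suc n) i) → T (leftLight c n i)
        shift i sel-i with leftLight-sound sel-i
        ... | through@(i∈T' , (_ , n<t) , light) , eb≤ =
          let eb≤n = ℕP.≤-pred (ℕP.≤∧≢⇒< eb≤ (heavy-not-bottleneck g g≡n not-light through))
          in leftLight-complete (i∈T' , (ℕP.≤-trans (proj₁ (bottleneck-on-path i)) eb≤n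
                                        , ℕP.<-trans (ℕP.n<1+n n) n<t) , light) eb≤n

    -- the c-light tasks through n with bottleneck at or right of n weigh at most c;
    -- the fuel m bounds the number of edges right of n
    right-sweep : ∀ m n → k ℕ.≤ m ℕ.+ n → sumSel (rightLight c n) d ≤ c
    right-sweep zero n k≤n = sweep-step _ n (λ _ → proj₁ ∘ rightLight-sound) no-edge
      where
      no-edge : (g : Fin k) → toℕ g ≡ n → ¬ toℚ (u g) < c → sumSel (rightLight c n) d ≤ c
      no-edge g g≡n _ = ⊥-elim (ℕP.<-irrefl g≡n (ℕP.<-≤-trans (FinP.toℕ<n g) k≤n))
    right-sweep (suc m) n k≤ = sweep-step _ n (λ _ → proj₁ ∘ rightLight-sound) heavy
      where
      heavy : (g : Fin k) → toℕ g ≡ n → ¬ toℚ (u g) < c → sumSel (rightLight c n) d ≤ c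
      heavy g g≡n not-light = QP.≤-trans (sumSel-mono shift)
        (right-sweep m (suc n) (subst (k ℕ.≤_) (sym (ℕP.+-suc m n)) k≤))
        where
        shift : ∀ i → T (rightLight c n i) → T (rightLight c (suc n) i)
        shift i sel-i with rightLight-sound sel-i
        ... | through@(i∈T' , (s≤n , _) , light) , n≤eb =
          let n<eb = ℕP.≤∧≢⇒< n≤eb (heavy-not-bottleneck g g≡n not-light through ∘ sym)
          in rightLight-complete (i∈T' , (ℕP.m≤n⇒m≤1+n s≤n
                                         , ℕP.≤-<-trans n<eb (proj₂ (bottleneck-on-path i))) , light) n<eb

  mtask-bottleneck : ∀ {a a₂ e} → eb a ≡ eb a₂ → _∈Pm_ I eb e (a , a₂) → u (eb a) ℕ.≤ u e
  mtask-bottleneck {a} _ (inj₁ e∈a) = proj₂ (eb-bottleneck a) _ e∈a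
  mtask-bottleneck {a₂ = a₂} same (inj₂ e∈a₂) rewrite same = proj₂ (eb-bottleneck a₂) _ e∈a₂

  module _ (δ : ℚ) (δ≥0 : 0ℚ ≤ δ) (δ≤1 : δ ≤ 1ℚ) {a a₂ : Fin N} {e : Fin k}
           (e∈m : _∈Pm_ I eb e (a , a₂)) where

    threshold : ℚ
    threshold = (½ * δ) * B a

    ½δ≤1 : ½ * δ ≤ 1ℚ
    ½δ≤1 = QP.≤-trans (scale-≤ (toWitness {a? = ½ QP.≤? 1ℚ} tt) δ≥0) δ≤1

    capacity-class : ∀ i → B a < B i ⊎ (B i ≤ B a × threshold ≤ B i) ⊎ B i < threshold
    capacity-class i = decide (B a QP.<? B i) (threshold QP.≤? B i)
      where
      decide : Dec (B a < B i) → Dec (threshold ≤ B i) →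
               B a < B i ⊎ (B i ≤ B a × threshold ≤ B i) ⊎ B i < threshold
      decide (yes above)    _                 = inj₁ above
      decide (no not-above) (yes critical)    = inj₂ (inj₁ (QP.≮⇒≥ not-above , critical))
      decide (no _)         (no not-critical) = inj₂ (inj₂ (QP.≰⇒> not-critical))

    classify : ∀ i → T (selTe I eb T' e i) →
               T (selAbv I eb T' e (a , a₂) i ∨ selCrit I eb δ T' e (a , a₂) i)
               ⊎ T (leftLight threshold (toℕ e) i ∨ rightLight threshold (toℕ e) i)
    classify i i∈Te = place (capacity-class i) (ℕP.≤-total (toℕ (eb i)) (toℕ e))
      where
      i∈T' : T (T' i)
      i∈T' = proj₁ (parts-∧ {T' i} i∈Te)
      e∈i? : T (does (_∈P?_ I e i))
      e∈i? = proj₂ (parts-∧ {T' i} i∈Te)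
      e∈i : _∈P_ I e i
      e∈i = does-sound (_∈P?_ I e i) e∈i?
      shares : T (does (shares? I eb i (a , a₂)))
      shares = does-complete (shares? I eb i (a , a₂)) (e , e∈i , e∈m)
      place : B a < B i ⊎ (B i ≤ B a × threshold ≤ B i) ⊎ B i < threshold →
              toℕ (eb i) ℕ.≤ toℕ e ⊎ toℕ e ℕ.≤ toℕ (eb i) →
              T (selAbv I eb T' e (a , a₂) i ∨ selCrit I eb δ T' e (a , a₂) i)
              ⊎ T (leftLight threshold (toℕ e) i ∨ rightLight threshold (toℕ e) i)
      place (inj₁ above) _ = inj₁ (Equivalence.from T-∨ (inj₁
        (both i∈T' (both shares (both e∈i? (does-complete (B a QP.<? B i) above))))))
      place (inj₂ (inj₁ (below , critical))) _ = inj₁ (Equivalence.from T-∨ (inj₂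
        (both i∈T' (both shares (both e∈i? (both (does-complete (B i QP.≤? B a) below)
                                                 (does-complete (threshold QP.≤? B i) critical)))))))
      place (inj₂ (inj₂ light)) (inj₁ eb≤e) =
        inj₂ (Equivalence.from T-∨ (inj₁ (leftLight-complete (i∈T' , e∈i , light) eb≤e)))
      place (inj₂ (inj₂ light)) (inj₂ e≤eb) =
        inj₂ (Equivalence.from T-∨ (inj₂ (rightLight-complete (i∈T' , e∈i , light) e≤eb)))

    load≤mtask : (∀ g → u g ℕ.< u e → load g ≤ toℚ (u g)) → eb a ≡ eb a₂ →
                 load e ≤ sumSel (selAbv I eb T' e (a , a₂)) d
                          + sumSel (selCrit I eb δ T' e (a , a₂)) d + dm I eb δ (a , a₂)
    load≤mtask IH same = begin
      load e
        ≤⟨ sumSel-cover {sel₁ = λ i → abv i ∨ crit i} {λ i → left i ∨ right i} classify ⟩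
      sumSel (λ i → abv i ∨ crit i) d + sumSel (λ i → left i ∨ right i) d
        ≤⟨ QP.+-mono-≤ (sumSel-∨ {abv} {crit}) (sumSel-∨ {left} {right}) ⟩
      (sumSel abv d + sumSel crit d) + (sumSel left d + sumSel right d)
        ≤⟨ QP.+-monoʳ-≤ (sumSel abv d + sumSel crit d)
             (QP.+-mono-≤ (left-sweep (toℕ e)) (right-sweep k (toℕ e) (ℕP.m≤m+n k _))) ⟩
      (sumSel abv d + sumSel crit d) + (threshold + threshold)
        ≡⟨ cong (sumSel abv d + sumSel crit d +_) (halves δ (B a)) ⟩
      sumSel abv d + sumSel crit d + δ * B a ∎
      where
      open QP.≤-Reasoning
      abv crit left right : Fin N → Bool
      abv = selAbv I eb T' e (a , a₂)
      crit = selCrit I eb δ T' e (a , a₂)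
      left = leftLight threshold (toℕ e)
      right = rightLight threshold (toℕ e)
      Ba≤ue : B a ≤ toℚ (u e)
      Ba≤ue = toℚ-mono (mtask-bottleneck same e∈m)
      threshold≤ue : threshold ≤ toℚ (u e)
      threshold≤ue = QP.≤-trans (scale-≤ ½δ≤1 (toℚ-nonneg (u (eb a)))) Ba≤ue
      below : FeasibleBelow threshold
      below g light = IH g (toℚ-cancel-< (QP.<-≤-trans light threshold≤ue))
      threshold≥0 : 0ℚ ≤ threshold
      threshold≥0 = scale-nonneg (scale-nonneg (toWitness {a? = 0ℚ QP.≤? ½} tt) δ≥0)
                                 (toℚ-nonneg (u (eb a)))
      open Sweep below threshold≥0

lemma5 : (I : Instance) → (eb : Fin (Instance.N I) → Fin (Instance.k I)) →
    Standing I eb →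
    (δ : ℚ) → 0ℚ < δ → δ ≤ 1ℚ →
    (T' : Fin (Instance.N I) → Bool) →
    (M' : Fin (Instance.N I) → Fin (Instance.N I) → Set) →
    MazePair I eb T' M' →
    WeaklyFeasible I eb δ T' M' →
    Feasible I eb T'
lemma5 I eb St δ δ>0 δ≤1 T' M' MP WF = measure-induction u (λ e → load e ≤ toℚ (u e)) bound
  where
  open Instance I
  open MazePair MP
  open Loads I eb St T'

  bound : ∀ e → (∀ g → u g ℕ.< u e → load g ≤ toℚ (u g)) → load e ≤ toℚ (u e)
  bound e IH = decidable-stable (load e QP.≤? toℚ (u e)) λ overloaded →
    overloaded (proj₂ (WF e) λ a a₂ m∈M' e∈m → no-mtask-through overloaded (a , a₂) (m∈M' , e∈m))
    where
    -- an m-task of M' through e of maximal bottleneck capacity would bound the load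
    no-mtask-through : ¬ load e ≤ toℚ (u e) → ∀ m → M' (proj₁ m) (proj₂ m) × _∈Pm_ I eb e m → ⊥
    no-mtask-through overloaded = refute-at-maximal _ (λ m → u (eb (proj₁ m))) (u e)
      (λ { (a , a₂) (m∈M' , e∈m) → mtask-bottleneck (M'-mtask a a₂ m∈M') e∈m })
      (λ { (a , a₂) (m∈M' , e∈m) maximal → overloaded (QP.≤-trans
          (load≤mtask δ (QP.<⇒≤ δ>0) δ≤1 e∈m IH (M'-mtask a a₂ m∈M'))
          (proj₁ (WF e) a a₂ m∈M' e∈m
            (λ a' a₂' m'∈M' e∈m' → toℚ-mono (maximal (a' , a₂') (m'∈M' , e∈m'))))) })
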